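{- Let $p$ be an odd prime and let $n$ be a positive integer. Suppose either $0<\gamma<p$ and $0<\delta\le\left\lfloor\frac{\gamma-1}{2}\right\rfloor$, or $\gamma=\delta=0$, and suppose $2n\ge\gamma$. Then $$\sum_{k=0}^{\lfloor (2n-\gamma)/p\rfloor}|X_{2n-\gamma}^{k}|=\sum_{\substack{k=\lceil n/p\rceil\\ n-k\equiv\delta \pmod{\frac{p-1}{2}}}}^{n}\left|X_{2n-\gamma}^{\frac{2(n-k-\delta)}{p-1}}\right|.$$
   Context: For integers $m\ge0$ and $j\ge 0$, $X_m^j$ denotes the set of permutations in the symmetric group $\mathfrak S_m$ which are products of exactly $j$ disjoint $p$-cycles (and $m-pj$ fixed points). Thus $|X_m^j|=\frac{m!}{j!\,(m-pj)!\,p^j}$ if $pj\le m$, and $|X_m^j|=0$ if $j>\lfloor m/p\rfloor$. -}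

module Defs where

open import Data.Nat using (ℕ; zero; suc; _+_; _*_; _∸_; _^_; _≤ᵇ_; _≡ᵇ_; _!)
open import Data.Nat.DivMod using (_/_; _%_)
open import Data.Bool using (if_then_else_)

-- Natural-number division, total (returns 0 on division by 0).
-- Only ever used where the divisor is nonzero.
_div_ : ℕ → ℕ → ℕ
a div zero = 0
a div (suc b) = a / suc b

-- Residue modulo d (a mod 0 := a; only used with d ≥ 1).
_mod_ : ℕ → ℕ → ℕ
a mod zero = a
a mod (suc b) = a % suc b

⌊_/_⌋ : ℕ → ℕ → ℕ
⌊ a / b ⌋ = a div b

⌈_/_⌉ : ℕ → ℕ → ℕ
⌈ a / b ⌉ = (a + (b ∸ 1)) div b

-- |X_m^j| for the prime p: number of permutations of 𝔖_m that are products of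
-- exactly j disjoint p-cycles:  m! / (j! (m-pj)! p^j) if pj ≤ m, and 0 otherwise.
cardX : (p m j : ℕ) → ℕ
cardX p m j = if p * j ≤ᵇ m then (m !) div ((j !) * ((m ∸ p * j) !) * p ^ j) else 0

sumFromTo : ℕ → ℕ → (ℕ → ℕ) → ℕ
sumFromTo a b f = go (suc b ∸ a)
  where
  go : ℕ → ℕ
  go zero = 0
  go (suc i) = f (a + i) + go i

sumFromToIf : ℕ → ℕ → (ℕ → Data.Bool.Bool) → (ℕ → ℕ) → ℕ
sumFromToIf a b P f = sumFromTo a b (λ k → if P k then f k else 0)

-- Write p = 2R + 1 and m = 2n − γ. Substituting t = n − k, the right-hand side sums,
-- over 0 ≤ t ≤ D := n − ⌈n/p⌉, the sequence q ↦ |X_m^q| dilated by R and shifted by δ: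
-- it equals |X_m^q| at t = δ + qR and vanishes elsewhere. As δ < R, each block of R
-- consecutive positions carries exactly one term, so this is Σ_{q ≤ Q} |X_m^q| for the
-- largest Q with δ + QR ≤ D. Since |X_m^q| = 0 once pq > m, the identity reduces to
-- δ + R⌊m/p⌋ ≤ D, i.e. to (δ + R⌊m/p⌋) p ≤ 2Rn, which follows from ⌊m/p⌋ p + γ ≤ 2n
-- and δp ≤ Rγ; the latter is exactly what the hypothesis on (γ, δ) provides.

{-# OPTIONS --safe #-}
module Submission where

open import Defs
open import Data.Nat using (ℕ; _+_; _*_; _∸_; _≤_; _<_; _≡ᵇ_)
open import Data.Nat.Primality using (Prime)
open import Data.Product using (_×_)
open import Data.Sum using (_⊎_)
open import Relation.Binary.PropositionalEquality using (_≡_)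

open import Data.Bool using (if_then_else_)
open import Data.Nat
  using (zero; suc; z≤n; s≤s; _≰_; _!; _^_; NonZero; >-nonZero⁻¹; nonTrivial⇒n>1; s≤s⁻¹)
open import Data.Nat.DivMod
  using (_/_; _%_; m≡m%n+[m/n]*n; [m+kn]%n≡m%n; m<n⇒m%n≡m; m*n%n≡0; m*n/n≡m; m/n*n≤m; m*n/m*o≡n/o;
         /-congˡ; /-monoˡ-≤; m/n≡0⇒m<n; +-distrib-/; m<n⇒m/n≡0)
open import Data.Nat.Primality using (prime⇒nonTrivial)
open import Data.Nat.Properties
open import Algebra.Properties.CommutativeSemigroup +-commutativeSemigroup using (x∙yz≈y∙xz)
open import Data.Nat.Tactic.RingSolver using (solve)
open import Data.List using ([]; _∷_)
open import Data.Product using (∃-syntax; _,_; proj₁; proj₂)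
open import Data.Sum using (inj₁; inj₂)
open import Relation.Nullary using (yes; no; contradiction)
open import Relation.Nullary.Decidable using (dec-true; dec-false)
open import Relation.Binary.PropositionalEquality
  using (_≢_; refl; sym; trans; cong; cong₂; subst; module ≡-Reasoning)

∑< : ℕ → (ℕ → ℕ) → ℕ
∑< zero    f = 0
∑< (suc n) f = f n + ∑< n f

syntax ∑< n (λ i → e) = ∑[ i < n ] e

∑<-cong : ∀ n {f g : ℕ → ℕ} → (∀ i → i < n → f i ≡ g i) → ∑< n f ≡ ∑< n g
∑<-cong zero    _  = refl
∑<-cong (suc n) eq = cong₂ _+_ (eq n ≤-refl) (∑<-cong n (λ i i<n → eq i (m<n⇒m<1+n i<n)))

∑<-+ : ∀ k m (f : ℕ → ℕ) → ∑[ t < k + m ] f t ≡ ∑[ i < k ] f (i + m) + ∑[ t < m ] f t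
∑<-+ zero    m f = refl
∑<-+ (suc k) m f = trans (cong (f (k + m) +_) (∑<-+ k m f)) (sym (+-assoc (f (k + m)) _ _))

∑<-shift : ∀ n (f : ℕ → ℕ) → ∑[ i < suc n ] f i ≡ f 0 + ∑[ i < n ] f (suc i)
∑<-shift zero    f = refl
∑<-shift (suc n) f = trans (cong (f (suc n) +_) (∑<-shift n f)) (x∙yz≈y∙xz (f (suc n)) (f 0) _)

∑<-reverse : ∀ n (f : ℕ → ℕ) → ∑[ i < n ] f (n ∸ suc i) ≡ ∑[ i < n ] f i
∑<-reverse zero    f = refl
∑<-reverse (suc n) f = trans (∑<-shift n (λ i → f (n ∸ i))) (cong (f n +_) (∑<-reverse n f))

∑<-truncate : ∀ {m n} {f : ℕ → ℕ} → m ≤ n → (∀ i → m ≤ i → i < n → f i ≡ 0) → ∑< n f ≡ ∑< m f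
∑<-truncate {n = zero} z≤n _ = refl
∑<-truncate {m} {suc n} {f} m≤1+n vanish with m≤n⇒m<n∨m≡n m≤1+n
... | inj₂ refl = refl
... | inj₁ m<1+n = trans (cong (_+ ∑< n f) (vanish n m≤n ≤-refl))
                         (∑<-truncate {f = f} m≤n (λ i m≤i i<n → vanish i m≤i (m<n⇒m<1+n i<n)))
  where
  m≤n : m ≤ n
  m≤n = s≤s⁻¹ m<1+n

-- sumFromTo a b f recurses on suc b ∸ a and does not otherwise depend on b, so rewriting
-- that count is enough to expose its next term.
sumFromTo-∑< : ∀ d a (f : ℕ → ℕ) → sumFromTo a (d + a) f ≡ ∑[ i < suc d ] f (a + i)
sumFromTo-∑< zero a f rewrite m+n∸n≡m 1 a = refl
sumFromTo-∑< (suc d) a f with sumFromTo-∑< d a f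
... | ih rewrite m+n∸n≡m (suc (suc d)) a | m+n∸n≡m (suc d) a = cong (f (a + suc d) +_) ih

if-≡ᵇ-yes : ∀ {m n} {A : Set} {x y : A} → m ≡ n → (if m ≡ᵇ n then x else y) ≡ x
if-≡ᵇ-yes {m} {n} m≡n rewrite dec-true (m ≟ n) m≡n = refl

if-≡ᵇ-no : ∀ {m n} {A : Set} {x y : A} → m ≢ n → (if m ≡ᵇ n then x else y) ≡ y
if-≡ᵇ-no {m} {n} m≢n rewrite dec-false (m ≟ n) m≢n = refl

if-≡ᵇ-cong : ∀ {m n} {A : Set} {x x′ y : A} → (m ≡ n → x ≡ x′) →
  (if m ≡ᵇ n then x else y) ≡ (if m ≡ᵇ n then x′ else y)
if-≡ᵇ-cong {m} {n} x≡x′ with m ≟ n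
... | yes m≡n = trans (if-≡ᵇ-yes m≡n) (trans (x≡x′ m≡n) (sym (if-≡ᵇ-yes m≡n)))
... | no  m≢n = trans (if-≡ᵇ-no m≢n) (sym (if-≡ᵇ-no m≢n))

∑<-indicator : ∀ {d n} x → d < n → ∑[ s < n ] (if s ≡ᵇ d then x else 0) ≡ x
∑<-indicator {d} {n} x d<n = begin
  ∑[ s < n ] indicator s
    ≡⟨ ∑<-truncate {f = indicator} d<n (λ s d<s _ → if-≡ᵇ-no (>⇒≢ d<s)) ⟩
  indicator d + ∑[ s < d ] indicator s
    ≡⟨ cong₂ _+_ (if-≡ᵇ-yes {d} refl)
                 (∑<-truncate {f = indicator} z≤n (λ s _ s<d → if-≡ᵇ-no (<⇒≢ s<d))) ⟩
  x + 0                          ≡⟨ +-identityʳ x ⟩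
  x                              ∎
  where
  open ≡-Reasoning
  indicator : ℕ → ℕ
  indicator s = if s ≡ᵇ d then x else 0

[m+kn]/n≡k : ∀ {m n} .{{_ : NonZero n}} k → m < n → (m + k * n) / n ≡ k
[m+kn]/n≡k {m} {n} k m<n = begin
  (m + k * n) / n       ≡⟨ +-distrib-/ m (k * n) remainders<n ⟩
  m / n + k * n / n     ≡⟨ cong₂ _+_ (m<n⇒m/n≡0 m<n) (m*n/n≡m k n) ⟩
  k                     ∎
  where
  open ≡-Reasoning
  remainders<n : m % n + k * n % n < n
  remainders<n = subst (_< n) (sym (trans (cong₂ _+_ (m<n⇒m%n≡m m<n) (m*n%n≡0 k n)) (+-identityʳ m))) m<n

dilate : (R d : ℕ) .{{_ : NonZero R}} → (ℕ → ℕ) → ℕ → ℕ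
dilate R d X t = if t % R ≡ᵇ d then X (t / R) else 0

dilate-block : ∀ {R} .{{_ : NonZero R}} d X q {s} → s < R →
  dilate R d X (s + q * R) ≡ (if s ≡ᵇ d then X q else 0)
dilate-block {R} d X q {s} s<R =
  cong₂ (λ r q′ → if r ≡ᵇ d then X q′ else 0)
        (trans ([m+kn]%n≡m%n s q R) (m<n⇒m%n≡m s<R)) ([m+kn]/n≡k q s<R)

∑<-dilate : ∀ {R d} .{{_ : NonZero R}} X → d < R → ∀ J →
  ∑[ t < J * R ] dilate R d X t ≡ ∑[ q < J ] X q
∑<-dilate         X d<R zero    = refl
∑<-dilate {R} {d} X d<R (suc J) = begin
  ∑[ t < R + J * R ] dilate R d X t
    ≡⟨ ∑<-+ R (J * R) (dilate R d X) ⟩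
  ∑[ s < R ] dilate R d X (s + J * R) + ∑[ t < J * R ] dilate R d X t
    ≡⟨ cong₂ _+_ block (∑<-dilate X d<R J) ⟩
  X J + ∑[ q < J ] X q
    ∎
  where
  open ≡-Reasoning
  block : ∑[ s < R ] dilate R d X (s + J * R) ≡ X J
  block = trans (∑<-cong R (λ s s<R → dilate-block d X J s<R)) (∑<-indicator (X J) d<R)

dilate-vanishes : ∀ {R d b t} .{{_ : NonZero R}} X → (∀ q → b < q → X q ≡ 0) →
  d + b * R < t → dilate R d X t ≡ 0
dilate-vanishes {R} {d} {b} {t} X vanish d+bR<t with t % R ≟ d
... | no  t%R≢d = if-≡ᵇ-no t%R≢d
... | yes t%R≡d = trans (if-≡ᵇ-yes t%R≡d)
                        (vanish (t / R) (*-cancelʳ-< R b (t / R) (+-cancelˡ-< d _ _ d+bR<d+qR)))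
  where
  d+bR<d+qR : d + b * R < d + t / R * R
  d+bR<d+qR = subst (d + b * R <_) (trans (m≡m%n+[m/n]*n t R) (cong (_+ t / R * R) t%R≡d)) d+bR<t

∑<-dilate-bounded : ∀ {R d b n} .{{_ : NonZero R}} X → d < R → (∀ q → b < q → X q ≡ 0) →
  d + b * R < n → ∑[ t < n ] dilate R d X t ≡ ∑[ q < suc b ] X q
∑<-dilate-bounded {R} {d} {b} {n} X d<R vanish d+bR<n = begin
  ∑[ t < n ] dilate R d X t                ≡⟨ ∑<-truncate {f = dilate R d X} d+bR<n beyond ⟩
  ∑[ t < suc (d + b * R) ] dilate R d X t
    ≡⟨ ∑<-truncate {f = dilate R d X} (+-monoˡ-< (b * R) d<R) beyond ⟨
  ∑[ t < suc b * R ] dilate R d X t        ≡⟨ ∑<-dilate X d<R (suc b) ⟩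
  ∑[ q < suc b ] X q                       ∎
  where
  open ≡-Reasoning
  beyond : ∀ {N} t → d + b * R < t → t < N → dilate R d X t ≡ 0
  beyond t d+bR<t _ = dilate-vanishes X vanish d+bR<t

summand≡dilate : ∀ {r d} X t → d < suc r →
  (if (t mod ((2 * suc r) div 2)) ≡ᵇ (d mod ((2 * suc r) div 2))
     then X ((2 * (t ∸ d)) div (2 * suc r)) else 0)
  ≡ dilate (suc r) d X t
summand≡dilate {r} {d} X t d<R = begin
  (if t mod ((2 * R) div 2) ≡ᵇ d mod ((2 * R) div 2) then X q else 0)
    ≡⟨ cong (λ h → if t mod h ≡ᵇ d mod h then X q else 0) (trans (/-congˡ {o = 2} (*-comm 2 R)) (m*n/n≡m R 2)) ⟩
  (if t % R ≡ᵇ d % R then X q else 0)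
    ≡⟨ cong (λ e → if t % R ≡ᵇ e then X q else 0) (m<n⇒m%n≡m d<R) ⟩
  (if t % R ≡ᵇ d then X q else 0)
    ≡⟨ if-≡ᵇ-cong (λ t%R≡d → cong X (quotient t%R≡d)) ⟩
  dilate R d X t
    ∎
  where
  open ≡-Reasoning
  R : ℕ
  R = suc r
  q : ℕ
  q = 2 * (t ∸ d) / (2 * R)
  quotient : t % R ≡ d → q ≡ t / R
  quotient t%R≡d = begin
    2 * (t ∸ d) / (2 * R)       ≡⟨ m*n/m*o≡n/o 2 (t ∸ d) R ⟩
    (t ∸ d) / R                 ≡⟨ /-congˡ (cong (_∸ d) (m≡m%n+[m/n]*n t R)) ⟩
    (t % R + t / R * R ∸ d) / R ≡⟨ /-congˡ (cong (λ x → x + t / R * R ∸ d) t%R≡d) ⟩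
    (d + t / R * R ∸ d) / R     ≡⟨ /-congˡ (m+n∸m≡n d (t / R * R)) ⟩
    t / R * R / R               ≡⟨ m*n/n≡m (t / R) R ⟩
    t / R                       ∎

cardX-vanishes : ∀ p m .{{_ : NonZero p}} j → m / p < j → cardX p m j ≡ 0
cardX-vanishes p m j m/p<j =
  cong (if_then (m !) div (j ! * (m ∸ p * j) ! * p ^ j) else 0) (dec-false (p * j ≤? m) pj≰m)
  where
  pj≰m : p * j ≰ m
  pj≰m pj≤m = <⇒≱ m/p<j (subst (_≤ m / p) (trans (/-congˡ (*-comm p j)) (m*n/n≡m j p)) (/-monoˡ-≤ p pj≤m))

+⌈/⌉≤ : ∀ {x n q} → x * suc q ≤ q * n → x + ⌈ n / suc q ⌉ ≤ n
+⌈/⌉≤ {x} {n} {q} xp≤qn = s≤s⁻¹ (*-cancelʳ-< (suc q) (x + a) (suc n) (begin-strict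
  (x + a) * suc q        ≡⟨ *-distribʳ-+ (suc q) x a ⟩
  x * suc q + a * suc q  ≤⟨ +-mono-≤ xp≤qn (m/n*n≤m (n + q) (suc q)) ⟩
  q * n + (n + q)        ≡⟨ solve (q ∷ n ∷ []) ⟩
  q + n * suc q          <⟨ n<1+n _ ⟩
  suc n * suc q          ∎))
  where
  open ≤-Reasoning
  a : ℕ
  a = ⌈ n / suc q ⌉

2*d<γ : ∀ {γ d} → 0 < γ → d ≤ ⌊ (γ ∸ 1) / 2 ⌋ → 2 * d < γ
2*d<γ {suc g} {d} _ d≤g/2 = s≤s (begin
  2 * d        ≤⟨ *-monoʳ-≤ 2 d≤g/2 ⟩
  2 * (g / 2)  ≡⟨ *-comm 2 (g / 2) ⟩
  g / 2 * 2    ≤⟨ m/n*n≤m g 2 ⟩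
  g            ∎)
  where open ≤-Reasoning

d*[1+2R]≤R*γ : ∀ {R d γ} → d ≤ R → 2 * d < γ → d * suc (2 * R) ≤ R * γ
d*[1+2R]≤R*γ {R} {d} {γ} d≤R 2d<γ = begin
  d * suc (2 * R)     ≡⟨ solve (d ∷ R ∷ []) ⟩
  d + R * (2 * d)     ≤⟨ +-monoˡ-≤ _ d≤R ⟩
  R + R * (2 * d)     ≡⟨ *-suc R (2 * d) ⟨
  R * suc (2 * d)     ≤⟨ *-monoʳ-≤ R 2d<γ ⟩
  R * γ               ∎
  where open ≤-Reasoning

Admissible : (p γ δ : ℕ) → Set
Admissible p γ δ = (0 < γ × γ < p × 0 < δ × δ ≤ ⌊ (γ ∸ 1) / 2 ⌋) ⊎ (γ ≡ 0 × δ ≡ 0)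

admissible-bounds : ∀ {R γ d} .{{_ : NonZero R}} → Admissible (suc (2 * R)) γ d →
  d < R × d * suc (2 * R) ≤ R * γ
admissible-bounds {R} {γ} {d} (inj₁ (0<γ , γ<p , _ , d≤⌊γ-1/2⌋)) = d<R , d*[1+2R]≤R*γ (<⇒≤ d<R) 2d<γ
  where
  2d<γ : 2 * d < γ
  2d<γ = 2*d<γ 0<γ d≤⌊γ-1/2⌋
  d<R : d < R
  d<R = *-cancelˡ-< 2 _ R (<-≤-trans 2d<γ (s≤s⁻¹ γ<p))
admissible-bounds {R} (inj₂ (refl , refl)) = >-nonZero⁻¹ R , z≤n

[d+bR]*[1+2R]≤2R*n : ∀ {R d γ b n} → d * suc (2 * R) ≤ R * γ → b * suc (2 * R) + γ ≤ 2 * n →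
  (d + b * R) * suc (2 * R) ≤ 2 * R * n
[d+bR]*[1+2R]≤2R*n {R} {d} {γ} {b} {n} dp≤Rγ bp+γ≤2n = begin
  (d + b * R) * suc (2 * R)            ≡⟨ solve (d ∷ b ∷ R ∷ []) ⟩
  d * suc (2 * R) + R * (b * suc (2 * R)) ≤⟨ +-monoˡ-≤ _ dp≤Rγ ⟩
  R * γ + R * (b * suc (2 * R))        ≡⟨ solve (R ∷ γ ∷ b ∷ []) ⟩
  R * (b * suc (2 * R) + γ)            ≤⟨ *-monoʳ-≤ R bp+γ≤2n ⟩
  R * (2 * n)                          ≡⟨ solve (R ∷ n ∷ []) ⟩
  2 * R * n                            ∎
  where open ≤-Reasoning

d+⌊m/p⌋*R≤n∸⌈n/p⌉ : ∀ {R γ d n} .{{_ : NonZero R}} → Admissible (suc (2 * R)) γ d → γ ≤ 2 * n →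
  d + (2 * n ∸ γ) / suc (2 * R) * R ≤ n ∸ ⌈ n / suc (2 * R) ⌉
d+⌊m/p⌋*R≤n∸⌈n/p⌉ {R} {γ} {d} {n} adm γ≤2n =
  m+n≤o⇒m≤o∸n (d + b * R) (+⌈/⌉≤ {n = n} {2 * R}
    ([d+bR]*[1+2R]≤2R*n {R} {d} {γ} {b} {n} (proj₂ (admissible-bounds adm)) bp+γ≤2n))
  where
  m : ℕ
  m = 2 * n ∸ γ
  b : ℕ
  b = m / suc (2 * R)
  bp+γ≤2n : b * suc (2 * R) + γ ≤ 2 * n
  bp+γ≤2n = subst (b * suc (2 * R) + γ ≤_) (m∸n+n≡m γ≤2n) (+-monoˡ-≤ γ (m/n*n≤m m (suc (2 * R))))

odd-prime-shape : ∀ {p} → Prime p → p % 2 ≡ 1 → ∃[ r ] p ≡ suc (2 * suc r)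
odd-prime-shape {p} p-prime p-odd with p / 2 in p/2≡q
... | zero  = contradiction (m/n≡0⇒m<n p/2≡q) (≤⇒≯ (nonTrivial⇒n>1 p {{prime⇒nonTrivial p-prime}}))
... | suc r = r , (begin
  p                    ≡⟨ m≡m%n+[m/n]*n p 2 ⟩
  p % 2 + p / 2 * 2    ≡⟨ cong₂ (λ x y → x + y * 2) p-odd p/2≡q ⟩
  1 + suc r * 2        ≡⟨ cong suc (*-comm (suc r) 2) ⟩
  suc (2 * suc r)      ∎)
  where open ≡-Reasoning

lemma4p2 : (p n γ δ : ℕ) → Prime p → p mod 2 ≡ 1 → 1 ≤ n →
    ((0 < γ × γ < p × 0 < δ × δ ≤ ⌊ (γ ∸ 1) / 2 ⌋) ⊎ (γ ≡ 0 × δ ≡ 0)) →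
    γ ≤ 2 * n →
    sumFromTo 0 ⌊ (2 * n ∸ γ) / p ⌋ (λ k → cardX p (2 * n ∸ γ) k)
      ≡ sumFromToIf ⌈ n / p ⌉ n
          (λ k → ((n ∸ k) mod ((p ∸ 1) div 2)) ≡ᵇ (δ mod ((p ∸ 1) div 2)))
          (λ k → cardX p (2 * n ∸ γ) ((2 * (n ∸ k ∸ δ)) div (p ∸ 1)))
lemma4p2 p n γ δ p-prime p-odd _ hyp γ≤2n with odd-prime-shape p-prime p-odd
... | r , refl = begin
  sumFromTo 0 b X                      ≡⟨ cong (λ c → sumFromTo 0 c X) (+-identityʳ b) ⟨
  sumFromTo 0 (b + 0) X                ≡⟨ sumFromTo-∑< b 0 X ⟩
  ∑[ q < suc b ] X q                   ≡⟨ ∑<-dilate-bounded X δ<R (cardX-vanishes p m) δ+bR<1+D ⟨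
  ∑[ t < suc D ] dilate R δ X t        ≡⟨ ∑<-reverse (suc D) (dilate R δ X) ⟨
  ∑[ i < suc D ] dilate R δ X (D ∸ i)  ≡⟨ ∑<-cong (suc D) (λ i _ → summand i) ⟩
  ∑[ i < suc D ] F (a + i)             ≡⟨ sumFromTo-∑< D a F ⟨
  sumFromTo a (D + a) F                ≡⟨ cong (λ c → sumFromTo a c F) (m∸n+n≡m a≤n) ⟩
  sumFromTo a n F                      ∎
  where
  open ≡-Reasoning
  R : ℕ
  R = suc r
  m : ℕ
  m = 2 * n ∸ γ
  X : ℕ → ℕ
  X = cardX p m
  b : ℕ
  b = m / p
  a : ℕ
  a = ⌈ n / p ⌉
  D : ℕ
  D = n ∸ a
  F : ℕ → ℕ
  F k = if ((n ∸ k) mod ((p ∸ 1) div 2)) ≡ᵇ (δ mod ((p ∸ 1) div 2))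
          then X ((2 * (n ∸ k ∸ δ)) div (p ∸ 1)) else 0
  δ<R : δ < R
  δ<R = proj₁ (admissible-bounds hyp)
  δ+bR<1+D : δ + b * R < suc D
  δ+bR<1+D = s≤s (d+⌊m/p⌋*R≤n∸⌈n/p⌉ {n = n} hyp γ≤2n)
  a≤n : a ≤ n
  a≤n = +⌈/⌉≤ {0} {n} {2 * R} z≤n
  summand : ∀ i → dilate R δ X (D ∸ i) ≡ F (a + i)
  summand i = trans (cong (dilate R δ X) (∸-+-assoc n a i)) (sym (summand≡dilate X (n ∸ (a + i)) δ<R))
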